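{- Each of the following intervals $[\mathcal{D}_1,\mathcal{D}_2]=\{\mathcal{K}\in{\bf E}_{\mathbb{B}}:\mathcal{D}_1\subseteq\mathcal{K}\subseteq\mathcal{D}_2\}$ contains uncountably many equational classes: (i) $[\mathcal{C}\cap\Lambda,\mathcal{C}\cap U_\infty]$ for $\mathcal{C}\in\{M_0,M_c\}$; (ii) $[\mathcal{C}\cap V,\mathcal{C}\cap W_\infty]$ for $\mathcal{C}\in\{M_1,M_c\}$.
   Context: Boolean functions are maps $\{0,1\}^n\to\{0,1\}$, $n\ge1$. An equational class is a set of Boolean functions closed under $f\mapsto f(p_1,\dots,p_n)$ for projections $p_i$; ${\bf E}_{\mathbb{B}}$ is the set of them. $M$ = monotone functions; $M_0=\{f\in M:f(0,\dots,0)=0\}$, $M_1=\{f\in M:f(1,\dots,1)=1\}$, $M_c=M_0\cap M_1$. $\Lambda$ = constants ${\bf 0},{\bf 1}$ and all conjunctions $x_{i_1}\wedge\cdots\wedge x_{i_k}$; $V$ = constants and all disjunctions $x_{i_1}\vee\cdots\vee x_{i_k}$. For $a\in\{0,1\}$, a set $B\subseteq\{0,1\}^n$ is $a$-separating if some coordinate $i$ has $b_i=a$ for all $b\in B$. $U_\infty$ (resp. $W_\infty$) is the class of functions $f$ for which $f^{ -1}(1)$ is $1$-separating (resp. $f^{ -1}(0)$ is $0$-separating). -}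

module Defs where

open import Data.Nat using (ℕ; suc)
open import Data.Fin using (Fin)
open import Data.Bool using (Bool; true; false; _≤_; _∧_; _∨_)
open import Data.List using (List; _∷_; foldr; map)
open import Data.Product using (Σ; ∃; _×_; _,_; proj₁)
open import Data.Sum using (_⊎_)
open import Relation.Binary.PropositionalEquality using (_≡_)
open import Relation.Nullary using (¬_)

BF : Set
BF = Σ ℕ (λ n → (Fin (suc n) → Bool) → Bool)

arity : BF → ℕ
arity (n , _) = suc n

app : (f : BF) → (Fin (arity f) → Bool) → Bool
app (_ , g) = g

_≈F_ : BF → BF → Set
f ≈F g = Σ (arity f ≡ arity g) λ { _≡_.refl → ∀ x → app f x ≡ app g x }

-- f(p_1,…,p_n) where p_j is the σ(j)-th projection of arity (suc m).
minor : (f : BF) (m : ℕ) → (Fin (arity f) → Fin (suc m)) → BF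
minor (n , g) m σ = m , (λ x → g (λ j → x (σ j)))

Class : Set₁
Class = BF → Set

_⊆_ : Class → Class → Set
A ⊆ B = ∀ f → A f → B f

_≐_ : Class → Class → Set
A ≐ B = (A ⊆ B) × (B ⊆ A)

_∩_ : Class → Class → Class
(A ∩ B) f = A f × B f

-- An equational class: closed under taking minors by projections.
-- (We additionally require that membership depends only on the function
-- as a map, i.e. respects pointwise equality, as sets of maps do.)
IsEquationalClass : Class → Set
IsEquationalClass K =
  (∀ f m σ → K f → K (minor f m σ)) ×
  (∀ f g → f ≈F g → K f → K g)

Monotone : Class
Monotone f = ∀ x y → (∀ i → x i ≤ y i) → app f x ≤ app f y

M : Class
M = Monotone

M₀ : Class
M₀ f = M f × (app f (λ _ → false) ≡ false)

M₁ : Class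
M₁ f = M f × (app f (λ _ → true) ≡ true)

Mc : Class
Mc = M₀ ∩ M₁

IsConst : Bool → Class
IsConst b f = ∀ x → app f x ≡ b

Λ : Class
Λ f = IsConst false f ⊎ IsConst true f ⊎
  Σ (Fin (arity f)) λ i → Σ (List (Fin (arity f))) λ is →
    ∀ x → app f x ≡ foldr _∧_ true (map x (i ∷ is))

V : Class
V f = IsConst false f ⊎ IsConst true f ⊎
  Σ (Fin (arity f)) λ i → Σ (List (Fin (arity f))) λ is →
    ∀ x → app f x ≡ foldr _∨_ false (map x (i ∷ is))

-- U∞ : f⁻¹(1) is 1-separating.
U∞ : Class
U∞ f = Σ (Fin (arity f)) λ i → ∀ x → app f x ≡ true → x i ≡ true

-- W∞ : f⁻¹(0) is 0-separating.
W∞ : Class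
W∞ f = Σ (Fin (arity f)) λ i → ∀ x → app f x ≡ false → x i ≡ false

Interval : Class → Class → Class → Set
Interval D₁ D₂ K = IsEquationalClass K × (D₁ ⊆ K) × (K ⊆ D₂)

Uncountable : (Class → Set) → Set₁
Uncountable P = ∀ (e : ℕ → Class) → ¬ (∀ K → P K → ∃ λ n → K ≐ e n)

-- Each interval is shown uncountable by a diagonal argument over an infinite
-- family of functions in the upper bound, none in the lower bound, none a minor
-- of another.  For an enumeration e of classes, take the lower bound together with
-- all minors of those members F n of the family with F n ∉ e n; this class is
-- equational and lies in the interval, but disagrees with each e n at F n.
-- For (i) the family is g_n(x₀,…,x_{n+3}) = x₀ ∧ "at least two of x₁,…,x_{n+3}":
-- it is monotone and 1-separated by x₀, it is not closed under meets of true
-- points (so not in Λ), and a minor of g_m equal to g_n must identify no two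
-- variables and miss none, forcing m = n.  For (ii) take the duals of the g_n.
module Submission where

open import Defs
open import Data.Bool using (Bool; true; false; _∧_; _∨_; not; f≤t; b≤b)
  renaming (_≤_ to _≤ᵇ_)
open import Data.Bool.Properties
  using (∧-conical; ∨-conical; ∨-zeroʳ; not-involutive; not-injective; not-¬; ¬-not;
         ≤-reflexive; ≤-antisym)
open import Data.Empty using (⊥; ⊥-elim)
open import Data.Fin using (Fin; zero; suc; punchIn; #_)
open import Data.Fin.Properties
  using (_≟_; any?; suc-injective; punchInᵢ≢i; cantor-schröder-bernstein)
open import Data.List using (List; []; _∷_; foldr; map)
open import Data.List.Membership.Propositional using (_∈_)
open import Data.List.Properties using (map-∘)
open import Data.List.Relation.Unary.Any using (here; there)
open import Data.Nat using (ℕ; _+_)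
import Data.Nat as ℕ
open import Data.Nat.Properties using (+-cancelˡ-≡)
open import Data.Product using (Σ; ∃; ∃₂; _×_; _,_; proj₁; proj₂)
open import Data.Sum using (_⊎_; inj₁; inj₂)
open import Function using (_∘_; id)
open import Function.Definitions using (Injective)
open import Relation.Binary.PropositionalEquality
open import Algebra.Definitions {A = Bool} _≡_ using (Conical)
open import Relation.Nullary using (¬_; yes; no; does)
open import Relation.Nullary.Decidable using (dec-true; dec-false)

implication⇒≤ : ∀ {a b} → (a ≡ true → b ≡ true) → a ≤ᵇ b
implication⇒≤ {false} {false} _ = b≤b
implication⇒≤ {false} {true}  _ = f≤t
implication⇒≤ {true}  a⇒b rewrite a⇒b refl = b≤b

≤⇒implication : ∀ {a b} → a ≤ᵇ b → a ≡ true → b ≡ true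
≤⇒implication b≤b = id
≤⇒implication f≤t ()

not-antitone : ∀ {a b} → a ≤ᵇ b → not b ≤ᵇ not a
not-antitone b≤b = b≤b
not-antitone f≤t = f≤t

not-swap : ∀ {a b} → not a ≡ b → a ≡ not b
not-swap {a} p = trans (sym (not-involutive a)) (cong not p)

true≢false : true ≢ false
true≢false ()

≈F-trans : ∀ f g h → f ≈F g → g ≈F h → f ≈F h
≈F-trans (_ , _) (_ , _) (_ , _) (refl , f≗g) (refl , g≗h) = refl , λ x → trans (f≗g x) (g≗h x)

monotone-cong : ∀ {f} → M f → ∀ {x y} → (∀ i → x i ≡ y i) → app f x ≡ app f y
monotone-cong mono x≗y =
  ≤-antisym (mono _ _ (≤-reflexive ∘ x≗y)) (mono _ _ (≤-reflexive ∘ sym ∘ x≗y))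

-- Definitionally M₀ = M ∩ Fixes false, M₁ = M ∩ Fixes true, U∞ = Separating true,
-- W∞ = Separating false, Λ = ConstOrFold _∧_ true and V = ConstOrFold _∨_ false.
Fixes : Bool → Class
Fixes b f = app f (λ _ → b) ≡ b

Separating : Bool → Class
Separating e f = Σ (Fin (arity f)) λ i → ∀ x → app f x ≡ e → x i ≡ e

ConstOrFold : (Bool → Bool → Bool) → Bool → Class
ConstOrFold _∙_ e f = IsConst false f ⊎ IsConst true f ⊎
  Σ (Fin (arity f)) λ i → Σ (List (Fin (arity f))) λ is →
    ∀ x → app f x ≡ foldr _∙_ e (map x (i ∷ is))

∩-equational : ∀ {A B} → IsEquationalClass A → IsEquationalClass B → IsEquationalClass (A ∩ B)
∩-equational (A-minor , A-≈) (B-minor , B-≈) =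
  (λ f m σ (a , b) → A-minor f m σ a , B-minor f m σ b) ,
  (λ f g f≈g (a , b) → A-≈ f g f≈g a , B-≈ f g f≈g b)

monotone-equational : IsEquationalClass M
monotone-equational = minor-closed , respects-≈
  where
  minor-closed : ∀ f m σ → M f → M (minor f m σ)
  minor-closed (_ , _) m σ mono x y x≤y = mono _ _ (x≤y ∘ σ)
  respects-≈ : ∀ f g → f ≈F g → M f → M g
  respects-≈ (_ , _) (_ , _) (refl , f≗g) mono x y x≤y =
    subst₂ _≤ᵇ_ (f≗g x) (f≗g y) (mono x y x≤y)

fixes-equational : ∀ b → IsEquationalClass (Fixes b)
fixes-equational b = minor-closed , respects-≈
  where
  minor-closed : ∀ f m σ → Fixes b f → Fixes b (minor f m σ)
  minor-closed (_ , _) _ _ fix = fix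
  respects-≈ : ∀ f g → f ≈F g → Fixes b f → Fixes b g
  respects-≈ (_ , _) (_ , _) (refl , f≗g) fix = trans (sym (f≗g _)) fix

separating-equational : ∀ e → IsEquationalClass (Separating e)
separating-equational e = minor-closed , respects-≈
  where
  minor-closed : ∀ f m σ → Separating e f → Separating e (minor f m σ)
  minor-closed (_ , _) m σ (i , sep) = σ i , λ x → sep (x ∘ σ)
  respects-≈ : ∀ f g → f ≈F g → Separating e f → Separating e g
  respects-≈ (_ , _) (_ , _) (refl , f≗g) (i , sep) = i , λ x gx → sep x (trans (f≗g x) gx)

constOrFold-equational : ∀ _∙_ e → IsEquationalClass (ConstOrFold _∙_ e)
constOrFold-equational _∙_ e = minor-closed , respects-≈
  where
  minor-closed : ∀ f m σ → ConstOrFold _∙_ e f → ConstOrFold _∙_ e (minor f m σ)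
  minor-closed (_ , _) m σ (inj₁ c)        = inj₁ λ _ → c _
  minor-closed (_ , _) m σ (inj₂ (inj₁ c)) = inj₂ (inj₁ λ _ → c _)
  minor-closed (_ , _) m σ (inj₂ (inj₂ (i , is , f≗fold))) =
    inj₂ (inj₂ (σ i , map σ is , λ x →
      trans (f≗fold (x ∘ σ)) (cong (foldr _∙_ e) (map-∘ (i ∷ is)))))
  respects-≈ : ∀ f g → f ≈F g → ConstOrFold _∙_ e f → ConstOrFold _∙_ e g
  respects-≈ (_ , _) (_ , _) (refl , f≗g) (inj₁ c) = inj₁ λ x → trans (sym (f≗g x)) (c x)
  respects-≈ (_ , _) (_ , _) (refl , f≗g) (inj₂ (inj₁ c)) =
    inj₂ (inj₁ λ x → trans (sym (f≗g x)) (c x))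
  respects-≈ (_ , _) (_ , _) (refl , f≗g) (inj₂ (inj₂ (i , is , f≗fold))) =
    inj₂ (inj₂ (i , is , λ x → trans (sym (f≗g x)) (f≗fold x)))

M₀-equational : IsEquationalClass M₀
M₀-equational = ∩-equational monotone-equational (fixes-equational false)

M₁-equational : IsEquationalClass M₁
M₁-equational = ∩-equational monotone-equational (fixes-equational true)

Mc-equational : IsEquationalClass Mc
Mc-equational = ∩-equational M₀-equational M₁-equational

U∞-equational : IsEquationalClass U∞
U∞-equational = separating-equational true

W∞-equational : IsEquationalClass W∞
W∞-equational = separating-equational false

Λ-equational : IsEquationalClass Λ
Λ-equational = constOrFold-equational _∧_ true

V-equational : IsEquationalClass V
V-equational = constOrFold-equational _∨_ false

Closed : (Bool → Bool → Bool) → Bool → Class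
Closed _∙_ e f = ∀ x y → app f x ≡ e → app f y ≡ e → app f (λ i → x i ∙ y i) ≡ e

IsConst-transfer : ∀ {b e} f {x y} → IsConst b f → app f x ≡ e → app f y ≡ e
IsConst-transfer f c fx≡e = trans (c _) (trans (sym (c _)) fx≡e)

module _ {_∙_ : Bool → Bool → Bool} {e : Bool} (conical : Conical e _∙_) where

  foldr-closed : ∀ {A : Set} → e ∙ e ≡ e → ∀ (x y : A → Bool) l →
    foldr _∙_ e (map x l) ≡ e → foldr _∙_ e (map y l) ≡ e →
    foldr _∙_ e (map (λ j → x j ∙ y j) l) ≡ e
  foldr-closed idem x y [] _ _ = refl
  foldr-closed idem x y (i ∷ l) p q =
    trans (cong₂ _∙_ (trans (cong₂ _∙_ (proj₁ conical _ _ p) (proj₁ conical _ _ q)) idem)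
                     (foldr-closed idem x y l (proj₂ conical _ _ p) (proj₂ conical _ _ q)))
          idem

  constOrFold-closed : e ∙ e ≡ e → ConstOrFold _∙_ e ⊆ Closed _∙_ e
  constOrFold-closed idem f (inj₁ c)        x y fx _ = IsConst-transfer f c fx
  constOrFold-closed idem f (inj₂ (inj₁ c)) x y fx _ = IsConst-transfer f c fx
  constOrFold-closed idem f (inj₂ (inj₂ (i , is , f≗fold))) x y fx fy =
    trans (f≗fold _)
      (foldr-closed idem x y (i ∷ is) (trans (sym (f≗fold x)) fx) (trans (sym (f≗fold y)) fy))

  -- A constant cannot take both values e and not e, so in the constant cases
  -- the separation condition is vacuous.
  constOrFold-separating : ∀ f → Fixes (not e) f → ConstOrFold _∙_ e f → Separating e f
  constOrFold-separating (_ , _) fix (inj₁ c) =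
    zero , λ x fx → ⊥-elim (not-¬ refl (trans (sym (IsConst-transfer (_ , _) c fx)) fix))
  constOrFold-separating (_ , _) fix (inj₂ (inj₁ c)) =
    zero , λ x fx → ⊥-elim (not-¬ refl (trans (sym (IsConst-transfer (_ , _) c fx)) fix))
  constOrFold-separating (_ , _) fix (inj₂ (inj₂ (i , is , f≗fold))) =
    i , λ x fx → proj₁ conical _ _ (trans (sym (f≗fold x)) fx)

Λ⊆U∞ : ∀ f → Fixes false f → Λ f → U∞ f
Λ⊆U∞ = constOrFold-separating ∧-conical

V⊆W∞ : ∀ f → Fixes true f → V f → W∞ f
V⊆W∞ = constOrFold-separating ∨-conical

Λ⊆∧-closed : Λ ⊆ Closed _∧_ true
Λ⊆∧-closed = constOrFold-closed ∧-conical refl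

V⊆∨-closed : V ⊆ Closed _∨_ false
V⊆∨-closed = constOrFold-closed ∨-conical refl

_≼_ : BF → BF → Set
f ≼ g = ∃₂ λ (k : ℕ) (σ : Fin (arity g) → Fin (ℕ.suc k)) → minor g k σ ≈F f

≼-refl : ∀ f → f ≼ f
≼-refl (n , _) = n , id , refl , λ _ → refl

minor-≼ : ∀ {f g} m τ → f ≼ g → minor f m τ ≼ g
minor-≼ {_ , _} {_ , _} m τ (_ , σ , refl , pw) = m , τ ∘ σ , refl , λ y → pw (y ∘ τ)

≈F-≼ : ∀ {f f′ g} → f ≈F f′ → f ≼ g → f′ ≼ g
≈F-≼ {f} {f′} {g} f≈f′ (k , σ , g≈f) = k , σ , ≈F-trans (minor g k σ) f f′ g≈f f≈f′

equational-≼ : ∀ {K f g} → IsEquationalClass K → K g → f ≼ g → K f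
equational-≼ {g = g} (K-minor , K-≈) Kg (k , σ , g≈f) = K-≈ _ _ g≈f (K-minor g k σ Kg)

module Diagonal {D U : Class} (D-equational : IsEquationalClass D)
  (U-equational : IsEquationalClass U) (D⊆U : D ⊆ U)
  (F : ℕ → BF) (F∈U : ∀ n → U (F n)) (F∉D : ∀ n → ¬ D (F n))
  (F-rigid : ∀ {m n} → F n ≼ F m → m ≡ n) where

  Diag : (ℕ → Class) → Class
  Diag e f = D f ⊎ ∃ λ n → ¬ e n (F n) × f ≼ F n

  Diag-equational : ∀ e → IsEquationalClass (Diag e)
  Diag-equational e = minor-closed , respects-≈
    where
    minor-closed : ∀ f m σ → Diag e f → Diag e (minor f m σ)
    minor-closed f m σ (inj₁ Df) = inj₁ (proj₁ D-equational f m σ Df)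
    minor-closed f m σ (inj₂ (n , F∉e , f≼F)) = inj₂ (n , F∉e , minor-≼ {f} {F n} m σ f≼F)
    respects-≈ : ∀ f g → f ≈F g → Diag e f → Diag e g
    respects-≈ f g f≈g (inj₁ Df) = inj₁ (proj₂ D-equational f g f≈g Df)
    respects-≈ f g f≈g (inj₂ (n , F∉e , f≼F)) = inj₂ (n , F∉e , ≈F-≼ {f} {g} {F n} f≈g f≼F)

  Diag∈Interval : ∀ e → Interval D U (Diag e)
  Diag∈Interval e = Diag-equational e , (λ _ → inj₁) , Diag⊆U
    where
    Diag⊆U : Diag e ⊆ U
    Diag⊆U f (inj₁ Df) = D⊆U f Df
    Diag⊆U f (inj₂ (n , _ , f≼F)) = equational-≼ U-equational (F∈U n) f≼F

  Diag-differs : ∀ e n → ¬ (Diag e ≐ e n)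
  Diag-differs e n (Diag⊆e , e⊆Diag) = F∉e (Diag⊆e (F n) (inj₂ (n , F∉e , ≼-refl (F n))))
    where
    F∉e : ¬ e n (F n)
    F∉e F∈e with e⊆Diag (F n) F∈e
    ... | inj₁ D-F = F∉D n D-F
    ... | inj₂ (m , F∉eₘ , F≼F) = F∉eₘ (subst (λ k → e k (F k)) (sym (F-rigid F≼F)) F∈e)

  interval-uncountable : Uncountable (Interval D U)
  interval-uncountable e enumerates =
    let n , Diag≐e = enumerates (Diag e) (Diag∈Interval e) in Diag-differs e n Diag≐e

interval-∩-uncountable : ∀ {C P Q} → IsEquationalClass C → IsEquationalClass P →
  IsEquationalClass Q → (∀ f → C f → P f → Q f) →
  (F : ℕ → BF) → (∀ n → C (F n)) → (∀ n → Q (F n)) → (∀ n → ¬ P (F n)) →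
  (∀ {m n} → F n ≼ F m → m ≡ n) → Uncountable (Interval (C ∩ P) (C ∩ Q))
interval-∩-uncountable C-eq P-eq Q-eq C∩P⊆Q F F∈C F∈Q F∉P F-rigid =
  Diagonal.interval-uncountable (∩-equational C-eq P-eq) (∩-equational C-eq Q-eq)
    (λ f (Cf , Pf) → Cf , C∩P⊆Q f Cf Pf) F (λ n → F∈C n , F∈Q n) (λ n → F∉P n ∘ proj₂) F-rigid

TwoTrue : ∀ {N} → (Fin N → Bool) → Set
TwoTrue x = ∃₂ λ a b → a ≢ b × x a ≡ true × x b ≡ true

TwoTrue-tail : ∀ {N} {x : Fin (ℕ.suc N) → Bool} → TwoTrue (x ∘ suc) → TwoTrue x
TwoTrue-tail (a , b , a≢b , xa , xb) = suc a , suc b , a≢b ∘ suc-injective , xa , xb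

atLeastOne : ∀ N → (Fin N → Bool) → Bool
atLeastOne ℕ.zero    _ = false
atLeastOne (ℕ.suc N) x = x zero ∨ atLeastOne N (x ∘ suc)

atLeastTwo : ∀ N → (Fin N → Bool) → Bool
atLeastTwo ℕ.zero    _ = false
atLeastTwo (ℕ.suc N) x = (x zero ∧ atLeastOne N (x ∘ suc)) ∨ atLeastTwo N (x ∘ suc)

atLeastOne⁺ : ∀ {N} x (a : Fin N) → x a ≡ true → atLeastOne N x ≡ true
atLeastOne⁺ x zero    xa rewrite xa = refl
atLeastOne⁺ x (suc a) xa = trans (cong (x zero ∨_) (atLeastOne⁺ (x ∘ suc) a xa)) (∨-zeroʳ _)

atLeastOne⁻ : ∀ {N} x → atLeastOne N x ≡ true → ∃ λ a → x a ≡ true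
atLeastOne⁻ {ℕ.suc N} x one with x zero in x₀
... | true  = zero , x₀
... | false = let a , xa = atLeastOne⁻ (x ∘ suc) one in suc a , xa

atLeastTwo⁺ : ∀ {N} x → TwoTrue x → atLeastTwo N x ≡ true
atLeastTwo⁺ x (zero  , zero  , a≢b , _  , _ ) = ⊥-elim (a≢b refl)
atLeastTwo⁺ x (zero  , suc b , _   , xa , xb) rewrite xa | atLeastOne⁺ (x ∘ suc) b xb = refl
atLeastTwo⁺ x (suc a , zero  , _   , xa , xb) rewrite xb | atLeastOne⁺ (x ∘ suc) a xa = refl
atLeastTwo⁺ x (suc a , suc b , a≢b , xa , xb) =
  trans (cong (x zero ∧ atLeastOne _ (x ∘ suc) ∨_)
             (atLeastTwo⁺ (x ∘ suc) (a , b , a≢b ∘ cong suc , xa , xb)))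
        (∨-zeroʳ _)

atLeastTwo⁻ : ∀ {N} x → atLeastTwo N x ≡ true → TwoTrue x
atLeastTwo⁻ {ℕ.suc N} x two with x zero in x₀ | atLeastOne N (x ∘ suc) in one
... | true  | true  = let b , xb = atLeastOne⁻ (x ∘ suc) one in zero , suc b , (λ ()) , x₀ , xb
... | true  | false = TwoTrue-tail (atLeastTwo⁻ (x ∘ suc) two)
... | false | _     = TwoTrue-tail (atLeastTwo⁻ (x ∘ suc) two)

indicator : ∀ {N} → List (Fin N) → Fin N → Bool
indicator []       j = false
indicator (k ∷ ks) j = does (j ≟ k) ∨ indicator ks j

indicator⁺ : ∀ {N} (ks : List (Fin N)) {j} → j ∈ ks → indicator ks j ≡ true
indicator⁺ (_ ∷ ks) {j} (here refl) = cong (_∨ indicator ks j) (dec-true (j ≟ j) refl)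
indicator⁺ (k ∷ ks) {j} (there j∈ks) =
  trans (cong (does (j ≟ k) ∨_) (indicator⁺ ks j∈ks)) (∨-zeroʳ _)

indicator⁻ : ∀ {N} (ks : List (Fin N)) j → indicator ks j ≡ true → j ∈ ks
indicator⁻ (k ∷ ks) j p with j ≟ k
... | yes j≡k = here j≡k
... | no  _   = there (indicator⁻ ks j p)

indicator-∷-≢ : ∀ {N} {k j : Fin N} ks → j ≢ k → indicator (k ∷ ks) j ≡ indicator ks j
indicator-∷-≢ {k = k} {j} ks j≢k = cong (_∨ indicator ks j) (dec-false (j ≟ k) j≢k)

three-in-pair : ∀ {A : Set} {p q u v w : A} → u ≢ v → u ≢ w → v ≢ w →
  u ∈ p ∷ q ∷ [] → v ∈ p ∷ q ∷ [] → w ∈ p ∷ q ∷ [] → ⊥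
three-in-pair u≢v _ _ (here refl) (here refl) _ = u≢v refl
three-in-pair u≢v _ _ (there (here refl)) (there (here refl)) _ = u≢v refl
three-in-pair _ u≢w _ (here refl) (there (here refl)) (here refl) = u≢w refl
three-in-pair _ _ v≢w (here refl) (there (here refl)) (there (here refl)) = v≢w refl
three-in-pair _ _ v≢w (there (here refl)) (here refl) (here refl) = v≢w refl
three-in-pair _ u≢w _ (there (here refl)) (here refl) (there (here refl)) = u≢w refl
three-in-pair _ _ _ (there (there ())) _ _
three-in-pair _ _ _ _ (there (there ())) _
three-in-pair _ _ _ _ _ (there (there ()))

g : ∀ n → (Fin (4 + n) → Bool) → Bool
g n x = x zero ∧ atLeastTwo (3 + n) (x ∘ suc)

G : ℕ → BF
G n = 3 + n , g n

G⁺ : ∀ {n} x → x zero ≡ true → TwoTrue (x ∘ suc) → g n x ≡ true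
G⁺ x x₀ two rewrite x₀ = atLeastTwo⁺ (x ∘ suc) two

G⁻ : ∀ {n} x → g n x ≡ true → x zero ≡ true × TwoTrue (x ∘ suc)
G⁻ x gx with x zero
... | true = refl , atLeastTwo⁻ (x ∘ suc) gx

g-upward : ∀ {n} x y → (∀ i → x i ≡ true → y i ≡ true) → g n x ≡ true → g n y ≡ true
g-upward x y x⇒y gx =
  let x₀ , a , b , a≢b , xa , xb = G⁻ x gx in
  G⁺ y (x⇒y _ x₀) (a , b , a≢b , x⇒y _ xa , x⇒y _ xb)

G-monotone : ∀ n → M (G n)
G-monotone n x y x≤y = implication⇒≤ (g-upward x y (λ i → ≤⇒implication (x≤y i)))

G-Mc : ∀ n → Mc (G n)
G-Mc n = (G-monotone n , refl) , (G-monotone n , refl)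

G-separating : ∀ n → U∞ (G n)
G-separating n = zero , λ x gx → proj₁ (G⁻ x gx)

g-pair : ∀ {n} (p q : Fin (4 + n)) → g n (indicator (p ∷ q ∷ [])) ≡ false
g-pair p q = ¬-not λ gx →
  let x₀ , a , b , a≢b , xa , xb = G⁻ (indicator pq) gx in
  three-in-pair (λ ()) (λ ()) (a≢b ∘ suc-injective)
    (indicator⁻ pq zero x₀) (indicator⁻ pq (suc a) xa) (indicator⁻ pq (suc b) xb)
  where
  pq = p ∷ q ∷ []

χ₀₁₂ χ₀₂₃ χ₀₂ : ∀ {n} → Fin (4 + n) → Bool
χ₀₁₂ = indicator (# 0 ∷ # 1 ∷ # 2 ∷ [])
χ₀₂₃ = indicator (# 0 ∷ # 2 ∷ # 3 ∷ [])
χ₀₂  = indicator (# 0 ∷ # 2 ∷ [])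

χ₀₁₂∧χ₀₂₃ : ∀ {n} (i : Fin (4 + n)) → χ₀₁₂ i ∧ χ₀₂₃ i ≡ χ₀₂ i
χ₀₁₂∧χ₀₂₃ zero                        = refl
χ₀₁₂∧χ₀₂₃ (suc zero)                  = refl
χ₀₁₂∧χ₀₂₃ (suc (suc zero))            = refl
χ₀₁₂∧χ₀₂₃ (suc (suc (suc zero)))      = refl
χ₀₁₂∧χ₀₂₃ (suc (suc (suc (suc _))))   = refl

G-not-∧-closed : ∀ n → ¬ Closed _∧_ true (G n)
G-not-∧-closed n closed = true≢false (begin
  true                          ≡⟨ sym (closed χ₀₁₂ χ₀₂₃ refl refl) ⟩
  g n (λ i → χ₀₁₂ i ∧ χ₀₂₃ i)   ≡⟨ monotone-cong (G-monotone n) χ₀₁₂∧χ₀₂₃ ⟩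
  g n χ₀₂                       ≡⟨ g-pair {n} (# 0) (# 2) ⟩
  false                         ∎)
  where open ≡-Reasoning

G∉Λ : ∀ n → ¬ Λ (G n)
G∉Λ n = G-not-∧-closed n ∘ Λ⊆∧-closed (G n)

module Rigidity {m n} (σ : Fin (4 + m) → Fin (4 + n)) (σ-minor : ∀ x → g m (x ∘ σ) ≡ g n x) where

  -- If σ sent 0 and two other positions into a pair, g m would be true on the
  -- pullback of that pair's indicator, on which g n vanishes.
  into-pair-impossible : ∀ {p q} c d → c ≢ d → σ zero ∈ p ∷ q ∷ [] →
    σ (suc c) ∈ p ∷ q ∷ [] → σ (suc d) ∈ p ∷ q ∷ [] → ⊥
  into-pair-impossible {p} {q} c d c≢d σ₀∈ σc∈ σd∈ = true≢false (begin
    true                              ≡⟨ sym (G⁺ (indicator pq ∘ σ) (indicator⁺ pq σ₀∈)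
                                            (c , d , c≢d , indicator⁺ pq σc∈ , indicator⁺ pq σd∈)) ⟩
    g m (indicator pq ∘ σ)            ≡⟨ σ-minor (indicator pq) ⟩
    g n (indicator pq)                ≡⟨ g-pair p q ⟩
    false                             ∎)
    where
    open ≡-Reasoning
    pq = p ∷ q ∷ []

  σ-injective : Injective _≡_ _≡_ σ
  σ-injective {a} {b} σa≡σb with a ≟ b
  ... | yes a≡b = a≡b
  ... | no  a≢b = ⊥-elim (no-collision a b a≢b σa≡σb)
    where
    no-collision : ∀ a b → a ≢ b → σ a ≡ σ b → ⊥
    no-collision zero    zero    a≢b _ = a≢b refl
    no-collision zero    (suc b) _   σ₀≡σb =
      into-pair-impossible b (punchIn b zero) (punchInᵢ≢i b zero ∘ sym)
        (here refl) (here (sym σ₀≡σb)) (there (here refl))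
    no-collision (suc a) zero    a≢b σa≡σ₀ = no-collision zero (suc a) (a≢b ∘ sym) (sym σa≡σ₀)
    no-collision (suc a) (suc b) a≢b σa≡σb =
      into-pair-impossible a b (a≢b ∘ cong suc) (here refl) (there (here refl))
        (there (here (sym σa≡σb)))

  -- If k is missed by σ, adding k to a set does not change the pullback,
  -- so g n would agree on {p, q} and {k, p, q}.
  not-missed : ∀ k p q → g n (indicator (k ∷ p ∷ q ∷ [])) ≡ true → (∀ i → σ i ≢ k) → ⊥
  not-missed k p q gkpq k∉σ = true≢false (begin
    true                                ≡⟨ sym gkpq ⟩
    g n (indicator (k ∷ pq))            ≡⟨ sym (σ-minor (indicator (k ∷ pq))) ⟩
    g m (indicator (k ∷ pq) ∘ σ)        ≡⟨ monotone-cong (G-monotone m)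
                                             (λ i → indicator-∷-≢ pq (k∉σ i)) ⟩
    g m (indicator pq ∘ σ)              ≡⟨ σ-minor (indicator pq) ⟩
    g n (indicator pq)                  ≡⟨ g-pair p q ⟩
    false                               ∎)
    where
    open ≡-Reasoning
    pq = p ∷ q ∷ []

  σ-surjective : ∀ k → ∃ λ i → σ i ≡ k
  σ-surjective k with any? (λ i → σ i ≟ k)
  ... | yes hit = hit
  ... | no  ¬hit = ⊥-elim (missed k (λ i σi≡k → ¬hit (i , σi≡k)))
    where
    missed : ∀ k → (∀ i → σ i ≢ k) → ⊥
    missed zero    = not-missed zero (# 1) (# 2) refl
    missed (suc k) = not-missed (suc k) zero (suc t)
      (G⁺ (indicator S) (indicator⁺ S (there (here refl)))
        (k , t , punchInᵢ≢i k zero ∘ sym , indicator⁺ S (here refl)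
           , indicator⁺ S (there (there (here refl)))))
      where
      t = punchIn k zero
      S = suc k ∷ zero ∷ suc t ∷ []

  σ⁻¹ : Fin (4 + n) → Fin (4 + m)
  σ⁻¹ = proj₁ ∘ σ-surjective

  σ⁻¹-injective : Injective _≡_ _≡_ σ⁻¹
  σ⁻¹-injective {a} {b} e =
    trans (sym (proj₂ (σ-surjective a))) (trans (cong σ e) (proj₂ (σ-surjective b)))

  m≡n : m ≡ n
  m≡n = +-cancelˡ-≡ 4 m n (cantor-schröder-bernstein σ-injective σ⁻¹-injective)

G-rigid : ∀ {m n} → G n ≼ G m → m ≡ n
G-rigid (_ , σ , refl , σ-minor) = Rigidity.m≡n σ σ-minor

dual : BF → BF
dual (n , f) = n , λ x → not (f (not ∘ x))

dual-monotone : ∀ f → M f → M (dual f)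
dual-monotone (_ , _) mono x y x≤y = not-antitone (mono _ _ (not-antitone ∘ x≤y))

dual-separating : ∀ e f → Separating e f → Separating (not e) (dual f)
dual-separating e (_ , f) (i , sep) = i , λ x dfx → not-swap (sep (not ∘ x) (not-injective dfx))

Gᵈ : ℕ → BF
Gᵈ = dual ∘ G

Gᵈ-Mc : ∀ n → Mc (Gᵈ n)
Gᵈ-Mc n = (dual-monotone (G n) (G-monotone n) , refl) , (dual-monotone (G n) (G-monotone n) , refl)

Gᵈ-separating : ∀ n → W∞ (Gᵈ n)
Gᵈ-separating n = dual-separating true (G n) (G-separating n)

not[not-χ₀₁₂∨not-χ₀₂₃] : ∀ {n} (i : Fin (4 + n)) → not (not (χ₀₁₂ i) ∨ not (χ₀₂₃ i)) ≡ χ₀₂ i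
not[not-χ₀₁₂∨not-χ₀₂₃] zero                      = refl
not[not-χ₀₁₂∨not-χ₀₂₃] (suc zero)                = refl
not[not-χ₀₁₂∨not-χ₀₂₃] (suc (suc zero))          = refl
not[not-χ₀₁₂∨not-χ₀₂₃] (suc (suc (suc zero)))    = refl
not[not-χ₀₁₂∨not-χ₀₂₃] (suc (suc (suc (suc _)))) = refl

Gᵈ-not-∨-closed : ∀ n → ¬ Closed _∨_ false (Gᵈ n)
Gᵈ-not-∨-closed n closed = true≢false (begin
  true                                          ≡⟨ cong not (sym (g-pair {n} (# 0) (# 2))) ⟩
  not (g n χ₀₂)                                 ≡⟨ cong not (monotone-cong (G-monotone n)
                                                     (sym ∘ not[not-χ₀₁₂∨not-χ₀₂₃])) ⟩
  not (g n (not ∘ λ i → not (χ₀₁₂ i) ∨ not (χ₀₂₃ i)))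
                                                ≡⟨ closed (not ∘ χ₀₁₂) (not ∘ χ₀₂₃) refl refl ⟩
  false                                         ∎)
  where open ≡-Reasoning

Gᵈ∉V : ∀ n → ¬ V (Gᵈ n)
Gᵈ∉V n = Gᵈ-not-∨-closed n ∘ V⊆∨-closed (Gᵈ n)

Gᵈ-rigid : ∀ {m n} → Gᵈ n ≼ Gᵈ m → m ≡ n
Gᵈ-rigid {m} {n} (_ , σ , refl , σ-minor) = Rigidity.m≡n σ λ x → begin
  g m (x ∘ σ)                      ≡⟨ monotone-cong (G-monotone m) (sym ∘ not-involutive ∘ x ∘ σ) ⟩
  g m (not ∘ not ∘ x ∘ σ)          ≡⟨ not-injective (σ-minor (not ∘ x)) ⟩
  g n (not ∘ not ∘ x)              ≡⟨ monotone-cong (G-monotone n) (not-involutive ∘ x) ⟩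
  g n x                            ∎
  where open ≡-Reasoning

proposition9 : Uncountable (Interval (M₀ ∩ Λ) (M₀ ∩ U∞)) ×
    Uncountable (Interval (Mc ∩ Λ) (Mc ∩ U∞)) ×
    Uncountable (Interval (M₁ ∩ V) (M₁ ∩ W∞)) ×
    Uncountable (Interval (Mc ∩ V) (Mc ∩ W∞))
proposition9 =
  interval-∩-uncountable M₀-equational Λ-equational U∞-equational
    (λ f (_ , fix) → Λ⊆U∞ f fix) G (proj₁ ∘ G-Mc) G-separating G∉Λ G-rigid ,
  interval-∩-uncountable Mc-equational Λ-equational U∞-equational
    (λ f ((_ , fix) , _) → Λ⊆U∞ f fix) G G-Mc G-separating G∉Λ G-rigid ,
  interval-∩-uncountable M₁-equational V-equational W∞-equational
    (λ f (_ , fix) → V⊆W∞ f fix) Gᵈ (proj₂ ∘ Gᵈ-Mc) Gᵈ-separating Gᵈ∉V Gᵈ-rigid ,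
  interval-∩-uncountable Mc-equational V-equational W∞-equational
    (λ f (_ , (_ , fix)) → V⊆W∞ f fix) Gᵈ Gᵈ-Mc Gᵈ-separating Gᵈ∉V Gᵈ-rigid
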